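{- For every $h \in \mathbb{N}$, the morphism $\varphi_h$ is irreducible and irreducible after the first position with respect to overlaps. Consequently $\varphi$ also has both these properties.
   Context: $\mathbb{N}=\{0,1,2,\ldots\}$ is an alphabet with its usual order; $x\cdot y$ denotes concatenation; $w[p]$ is the $p$th letter of $w$ (indexing from 1). An overlap is a word $cxcxc$ with $c$ a letter and $x$ a possibly empty word. A word $w$ is irreducible at position $p$ (with respect to overlaps) if replacing $w[p]$ by any strictly smaller letter of $\mathbb{N}$ produces a word having an overlap as a factor ending at position $p$ (in particular this holds automatically if $w[p]=0$; $w$ itself may already contain an overlap ending at $p$). A word is irreducible if it is irreducible at every position, and irreducible after the first position if it is irreducible at positions $2,\ldots,|w|$. A morphism is irreducible (resp. irreducible after the first position) if it maps every word with that property (in its domain) to a word with that property. $S$ is the left cyclic shift $S(cx)=xc$ and $S^{ -1}$ its inverse, $S^{ -1}(xc)=cx$. For each $h\in\mathbb{N}$ the morphism $\varphi_h \colon \{0,\ldots,h\}^* \to \{0,\ldots,h+1\}^*$ is defined recursively by $\varphi_h(h') = \varphi_{h'}(h')$ for $h'<h$ and $\varphi_h(h) = \big(S^{ -1}(\varphi_{h-1}\circ\cdots\circ\varphi_0(00))\big)\cdot(h+1)$ (so $\varphi_0(0)=001$); $\varphi\colon\mathbb{N}^*\to\mathbb{N}^*$ is the common extension of all $\varphi_h$, i.e. $\varphi(h)=S^{ -1}(\varphi^h(00))\cdot(h+1)$. -}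

module Defs where

open import Data.Nat using (ℕ; zero; suc; _+_; _*_; _≤_; _<_)
open import Data.List using (List; []; _∷_; _++_; length; reverse; concatMap; [_])
open import Data.List.Relation.Unary.All using (All)
open import Data.Product using (Σ; _×_; ∃; ∃-syntax)
open import Relation.Binary.PropositionalEquality using (_≡_)

Word : Set
Word = List ℕ

overlapWord : ℕ → Word → Word
overlapWord c x = c ∷ (x ++ (c ∷ (x ++ [ c ])))

-- w has an overlap as a factor ending at position p (positions counted from 1):
-- w = u · (c x c x c) · v  with |u| + |cxcxc| = p.
OverlapEndsAt : Word → ℕ → Set
OverlapEndsAt w p =
  ∃[ u ] ∃[ c ] ∃[ x ] ∃[ v ]
    (w ≡ u ++ (overlapWord c x ++ v)) × (length u + length (overlapWord c x) ≡ p)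

IrreducibleAt : Word → ℕ → Set
IrreducibleAt w p =
  ∀ (u : Word) (b : ℕ) (v : Word) → w ≡ u ++ (b ∷ v) → length u + 1 ≡ p →
  ∀ (a : ℕ) → a < b → OverlapEndsAt (u ++ (a ∷ v)) p

Irreducible : Word → Set
Irreducible w = ∀ p → 1 ≤ p → p ≤ length w → IrreducibleAt w p

IrreducibleAfterFirst : Word → Set
IrreducibleAfterFirst w = ∀ p → 2 ≤ p → p ≤ length w → IrreducibleAt w p

-- Inverse cyclic shift S⁻¹(x c) = c x  (S⁻¹ of the empty word is empty).
Sinv : Word → Word
Sinv w with reverse w
... | []    = []
... | c ∷ r = c ∷ reverse r

-- lookup in a table of letter images (out of range: empty word; never used
-- on the relevant domains)
lookupD : List Word → ℕ → Word
lookupD []       _       = []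
lookupD (x ∷ xs) zero    = x
lookupD (x ∷ xs) (suc n) = lookupD xs n

applyTab : List Word → Word → Word
applyTab t w = concatMap (lookupD t) w

mutual
  -- phiTab h = [ φ_h(0) , … , φ_h(h) ]
  phiTab : ℕ → List Word
  phiTab zero    = [ 0 ∷ 0 ∷ 1 ∷ [] ]
  phiTab (suc h) = phiTab h ++ [ Sinv (chain (suc h) (0 ∷ 0 ∷ [])) ++ [ suc (suc h) ] ]

  chain : ℕ → Word → Word
  chain zero    w = w
  chain (suc n) w = applyTab (phiTab n) (chain n w)

-- φ_h : {0,…,h}* → {0,…,h+1}*  (applied to words with all letters ≤ h)
phiH : ℕ → Word → Word
phiH h w = applyTab (phiTab h) w

phiLetter : ℕ → Word
phiLetter a = lookupD (phiTab a) a

phi : Word → Word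
phi w = concatMap phiLetter w

IrreducibleMorphismH : ℕ → Set
IrreducibleMorphismH h =
  ∀ (w : Word) → All (_≤ h) w → Irreducible w → Irreducible (phiH h w)

IrreducibleAfterFirstMorphismH : ℕ → Set
IrreducibleAfterFirstMorphismH h =
  ∀ (w : Word) → All (_≤ h) w → IrreducibleAfterFirst w → IrreducibleAfterFirst (phiH h w)

IrreducibleMorphismPhi : Set
IrreducibleMorphismPhi = ∀ (w : Word) → Irreducible w → Irreducible (phi w)

IrreducibleAfterFirstMorphismPhi : Set
IrreducibleAfterFirstMorphismPhi =
  ∀ (w : Word) → IrreducibleAfterFirst w → IrreducibleAfterFirst (phi w)

-- Call a word W admissible for the letter a if it starts with a and is irreducible after its
-- first position.  A morphism sending every letter to an admissible word preserves both
-- irreducibility and irreducibility after the first position: a position inside some f(b),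
-- other than its first one, inherits irreducibility from f(b); at the first letter b of f(b),
-- lowering b to a < b gave an overlap a x a x a ending right after w₁ in w, and then f(w₁) a
-- ends with the overlap a y a y a, where y = r f(x) and f(a) = a r.
-- Writing φⁿ(00) = X n X n (the last letter of φⁿ(0) is n), we get φ(n) = n X n X (n+1); this
-- word is admissible for n as soon as φⁿ(00) is irreducible, which closes an induction on n
-- since φⁿ⁺¹(00) = φ(φⁿ(00)) and φⁿ(00) only uses letters ≤ n.
module Submission where

open import Defs
open import Data.Nat using (ℕ; zero; suc; pred; _+_; _≤_; _<_; z≤n; s≤s)
open import Data.Nat.Properties
  using (≤-refl; ≤-trans; <⇒≤; n≤1+n; ≤-pred; m≤n⇒m<n∨m≡n; +-comm; +-monoʳ-≤)
open import Data.Nat.Induction using (<-rec)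
open import Data.List using (List; []; _∷_; _++_; _∷ʳ_; [_]; length; reverse; concatMap)
open import Data.List.Properties
  using (++-assoc; ++-identityʳ; ∷-injective; ∷-injectiveˡ; ∷ʳ-injective; ∷ʳ-++; length-++;
         concatMap-++; reverse-++; reverse-involutive)
open import Data.List.Relation.Unary.All as All using (All; []; _∷_)
open import Data.List.Relation.Unary.All.Properties using (++⁺; ++⁻ˡ; ++⁻ʳ; concat⁺; map⁺)
open import Data.Product using (_×_; _,_; proj₁; proj₂; ∃-syntax)
open import Data.Sum using (_⊎_; inj₁; inj₂)
open import Function.Bundles using (_⇔_; mk⇔; Equivalence)
open import Relation.Binary.PropositionalEquality
  using (_≡_; refl; sym; trans; cong; subst; module ≡-Reasoning)

++-prefix-unique : ∀ (xs ys : Word) {zs ws} →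
  xs ++ zs ≡ ys ++ ws → length xs ≡ length ys → xs ≡ ys
++-prefix-unique []       []       _  _  = refl
++-prefix-unique (x ∷ xs) (y ∷ ys) eq len with refl , eq′ ← ∷-injective eq =
  cong (x ∷_) (++-prefix-unique xs ys eq′ (cong pred len))

++-split : ∀ (xs : Word) {ys} u {b v} → xs ++ ys ≡ u ++ b ∷ v →
  (∃[ q ] xs ≡ u ++ b ∷ q) ⊎ (∃[ u′ ] u ≡ xs ++ u′ × ys ≡ u′ ++ b ∷ v)
++-split []       u       eq   = inj₂ (u , refl , eq)
++-split (x ∷ xs) []      refl = inj₁ (xs , refl)
++-split (x ∷ xs) (_ ∷ u) eq with refl , eq′ ← ∷-injective eq with ++-split xs u eq′
... | inj₁ (q , xs≡)       = inj₁ (q , cong (x ∷_) xs≡)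
... | inj₂ (u′ , u≡ , ys≡) = inj₂ (u′ , cong (x ∷_) u≡ , ys≡)

∷ʳ-split : ∀ (xs : Word) {e} u {b v} → xs ∷ʳ e ≡ u ++ b ∷ v →
  (u ≡ xs × b ≡ e) ⊎ (∃[ q ] xs ≡ u ++ b ∷ q)
∷ʳ-split xs u eq with ++-split xs u eq
... | inj₁ split                   = inj₂ split
... | inj₂ ([]    , u≡ , refl)     = inj₁ (trans u≡ (++-identityʳ xs) , refl)
... | inj₂ (_ ∷ []    , _  , ())
... | inj₂ (_ ∷ _ ∷ _ , _  , ())

EndsWithOverlap : Word → Set
EndsWithOverlap s = ∃[ u ] ∃[ c ] ∃[ x ] s ≡ u ++ overlapWord c x

EndsWithOverlap-++ˡ : ∀ t {s} → EndsWithOverlap s → EndsWithOverlap (t ++ s)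
EndsWithOverlap-++ˡ t (u , c , x , eq) =
  t ++ u , c , x , trans (cong (t ++_) eq) (sym (++-assoc t u (overlapWord c x)))

overlapWord-∷ʳ : ∀ c (x : Word) → (c ∷ x ++ c ∷ x) ∷ʳ c ≡ overlapWord c x
overlapWord-∷ʳ c x = cong (c ∷_) (++-assoc x (c ∷ x) [ c ])

IrreducibleAfter : Word → ℕ → Set
IrreducibleAfter u b = ∀ a → a < b → EndsWithOverlap (u ∷ʳ a)

IrreducibleAfter-++ˡ : ∀ t {u b} → IrreducibleAfter u b → IrreducibleAfter (t ++ u) b
IrreducibleAfter-++ˡ t {u} irr a a<b =
  subst EndsWithOverlap (sym (++-assoc t u [ a ])) (EndsWithOverlap-++ˡ t (irr a a<b))

-- Irreducible = IrreducibleFrom 1 and IrreducibleAfterFirst = IrreducibleFrom 2, definitionally.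
IrreducibleFrom : ℕ → Word → Set
IrreducibleFrom k w = ∀ p → k ≤ p → p ≤ length w → IrreducibleAt w p

IrreducibleFrom′ : ℕ → Word → Set
IrreducibleFrom′ k w = ∀ u b v → w ≡ u ++ b ∷ v → k ≤ suc (length u) → IrreducibleAfter u b

OverlapEndsAt⇔EndsWithOverlap : ∀ u a v →
  OverlapEndsAt (u ++ a ∷ v) (length u + 1) ⇔ EndsWithOverlap (u ∷ʳ a)
OverlapEndsAt⇔EndsWithOverlap u a v = mk⇔ to from
  where
  to : OverlapEndsAt (u ++ a ∷ v) (length u + 1) → EndsWithOverlap (u ∷ʳ a)
  to (u₀ , c , x , v₀ , eq , len) = u₀ , c , x ,
    ++-prefix-unique (u ∷ʳ a) (u₀ ++ overlapWord c x)
      (trans (∷ʳ-++ u a v) (trans eq (sym (++-assoc u₀ (overlapWord c x) v₀))))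
      (trans (length-++ u) (sym (trans (length-++ u₀) len)))
  from : EndsWithOverlap (u ∷ʳ a) → OverlapEndsAt (u ++ a ∷ v) (length u + 1)
  from (u₀ , c , x , eq) = u₀ , c , x , v ,
    trans (sym (∷ʳ-++ u a v)) (trans (cong (_++ v) eq) (++-assoc u₀ (overlapWord c x) v)) ,
    trans (sym (length-++ u₀)) (trans (cong length (sym eq)) (length-++ u))

IrreducibleFrom⇔IrreducibleFrom′ : ∀ k w → IrreducibleFrom k w ⇔ IrreducibleFrom′ k w
IrreducibleFrom⇔IrreducibleFrom′ k w = mk⇔ to from
  where
  to : IrreducibleFrom k w → IrreducibleFrom′ k w
  to irr u b v refl k≤ a a<b = Equivalence.to (OverlapEndsAt⇔EndsWithOverlap u a v)
    (irr (length u + 1) (subst (k ≤_) (+-comm 1 (length u)) k≤)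
         (subst (length u + 1 ≤_) (sym (length-++ u)) (+-monoʳ-≤ (length u) (s≤s z≤n)))
         u b v refl refl a a<b)
  from : IrreducibleFrom′ k w → IrreducibleFrom k w
  from irr′ _ k≤p _ u b v eq refl a a<b =
    Equivalence.from (OverlapEndsAt⇔EndsWithOverlap u a v)
      (irr′ u b v eq (subst (k ≤_) (+-comm (length u) 1) k≤p) a a<b)

record Admissible (a : ℕ) (W : Word) : Set where
  field
    rest                  : Word
    starts-with           : W ≡ a ∷ rest
    irreducibleAfterFirst : IrreducibleFrom′ 2 W

AdmissibleUpTo : (ℕ → Word) → ℕ → Set
AdmissibleUpTo f b = ∀ {a} → a ≤ b → Admissible a (f a)

All-AdmissibleUpTo : ∀ {f n w} → (∀ {a} → a ≤ n → Admissible a (f a)) →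
  All (_≤ n) w → All (AdmissibleUpTo f) w
All-AdmissibleUpTo admissible = All.map (λ b≤n {a} a≤b → admissible (≤-trans a≤b b≤n))

record ImagePosition (f : ℕ → Word) (w u : Word) (c : ℕ) : Set where
  constructor image
  field
    w₁ : Word
    b  : ℕ
    w₂ : Word
    p q : Word
    w-split  : w ≡ w₁ ++ b ∷ w₂
    fb-split : f b ≡ p ++ c ∷ q
    u-split  : u ≡ concatMap f w₁ ++ p

imagePosition : ∀ f w u {c v} → concatMap f w ≡ u ++ c ∷ v → ImagePosition f w u c
imagePosition f []      []      ()
imagePosition f (b ∷ w) u       eq with ++-split (f b) u eq
... | inj₁ (q , fb≡)       = image [] b w u q refl fb≡ refl
... | inj₂ (u′ , u≡ , eq′) with imagePosition f w u′ eq′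
... | image w₁ b′ w₂ p q w≡ fb′≡ u′≡ =
  image (b ∷ w₁) b′ w₂ p q (cong (b ∷_) w≡) fb′≡
    (trans u≡ (trans (cong (f b ++_) u′≡) (sym (++-assoc (f b) (concatMap f w₁) p))))

concatMap-square : ∀ f {a r} x → f a ≡ a ∷ r →
  concatMap f (a ∷ x ++ a ∷ x) ≡ a ∷ (r ++ concatMap f x) ++ a ∷ (r ++ concatMap f x)
concatMap-square f {a} {r} x fa≡ = begin
  f a ++ concatMap f (x ++ a ∷ x)      ≡⟨ cong (f a ++_) (concatMap-++ f x (a ∷ x)) ⟩
  f a ++ F x ++ f a ++ F x             ≡⟨ cong (λ y → y ++ F x ++ y ++ F x) fa≡ ⟩
  a ∷ r ++ F x ++ a ∷ r ++ F x         ≡⟨ cong (a ∷_) (sym (++-assoc r (F x) _)) ⟩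
  a ∷ (r ++ F x) ++ a ∷ (r ++ F x)     ∎
  where
  open ≡-Reasoning
  F : Word → Word
  F = concatMap f

concatMap-IrreducibleAfter : ∀ f w {b} →
  AdmissibleUpTo f b → IrreducibleAfter w b → IrreducibleAfter (concatMap f w) b
concatMap-IrreducibleAfter f w adm irr a a<b with irr a a<b
... | u , c , x , eq
  with refl , refl ← ∷ʳ-injective w (u ++ c ∷ x ++ c ∷ x)
                       (trans eq (trans (cong (u ++_) (sym (overlapWord-∷ʳ c x)))
                                        (sym (++-assoc u (c ∷ x ++ c ∷ x) [ c ]))))
  = F u , a , r ++ F x , (begin
    F (u ++ a ∷ x ++ a ∷ x) ∷ʳ a                    ≡⟨ cong (_∷ʳ a) (concatMap-++ f u _) ⟩
    (F u ++ F (a ∷ x ++ a ∷ x)) ∷ʳ a                ≡⟨ ++-assoc (F u) _ [ a ] ⟩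
    F u ++ F (a ∷ x ++ a ∷ x) ∷ʳ a                  ≡⟨ cong (λ y → F u ++ y ∷ʳ a)
                                                         (concatMap-square f x starts-with) ⟩
    F u ++ (a ∷ (r ++ F x) ++ a ∷ (r ++ F x)) ∷ʳ a  ≡⟨ cong (F u ++_) (overlapWord-∷ʳ a (r ++ F x)) ⟩
    F u ++ overlapWord a (r ++ F x)                 ∎)
  where
  open ≡-Reasoning
  open Admissible (adm (<⇒≤ a<b)) renaming (rest to r)
  F : Word → Word
  F = concatMap f

-- k ≤ 2 is needed: f may move a position of w to the right, but f(w₁) is empty only if w₁ is.
≤-position-preimage : ∀ {k} (f : ℕ → Word) w₁ →
  k ≤ 2 → k ≤ suc (length (concatMap f w₁)) → k ≤ suc (length w₁)
≤-position-preimage f []      _   k≤ = k≤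
≤-position-preimage f (_ ∷ _) k≤2 _  = ≤-trans k≤2 (s≤s (s≤s z≤n))

concatMap-IrreducibleFrom′ : ∀ {k} f w → k ≤ 2 →
  All (AdmissibleUpTo f) w → IrreducibleFrom′ k w → IrreducibleFrom′ k (concatMap f w)
concatMap-IrreducibleFrom′ f w k≤2 adm irr u c v eq k≤
  with image w₁ b w₂ p q w≡ fb≡ u≡ ← imagePosition f w u eq
  with admissible ← All.head (++⁻ʳ w₁ (subst (All (AdmissibleUpTo f)) w≡ adm))
  with p
... | [] with refl ← ∷-injectiveˡ (trans (sym (Admissible.starts-with (admissible ≤-refl))) fb≡) =
  subst (λ u → IrreducibleAfter u c) (sym (trans u≡ (++-identityʳ _)))
    (concatMap-IrreducibleAfter f w₁ admissible
      (irr w₁ b w₂ w≡ (≤-position-preimage f w₁ k≤2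
        (subst (λ u → _ ≤ suc (length u)) (trans u≡ (++-identityʳ _)) k≤))))
... | p₁ ∷ p′ =
  subst (λ u → IrreducibleAfter u c) (sym u≡)
    (IrreducibleAfter-++ˡ (concatMap f w₁)
      (Admissible.irreducibleAfterFirst (admissible ≤-refl) (p₁ ∷ p′) c q fb≡ (s≤s (s≤s z≤n))))

concatMap-IrreducibleFrom : ∀ {k} f w → k ≤ 2 →
  All (AdmissibleUpTo f) w → IrreducibleFrom k w → IrreducibleFrom k (concatMap f w)
concatMap-IrreducibleFrom {k} f w k≤2 adm irr =
  Equivalence.from (IrreducibleFrom⇔IrreducibleFrom′ k (concatMap f w))
    (concatMap-IrreducibleFrom′ f w k≤2 adm
      (Equivalence.to (IrreducibleFrom⇔IrreducibleFrom′ k w) irr))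

-- The last letter k + 1 is irreducible because k X k X k is an overlap.
rotate-IrreducibleFrom′ : ∀ k X → IrreducibleFrom′ 1 ((X ++ k ∷ X) ∷ʳ k) →
  IrreducibleFrom′ 2 (k ∷ (X ++ k ∷ X) ∷ʳ suc k)
rotate-IrreducibleFrom′ k X irr []      _ _ _  (s≤s ())
rotate-IrreducibleFrom′ k X irr (_ ∷ u) b v eq _
  with refl , eq′ ← ∷-injective eq with ∷ʳ-split (X ++ k ∷ X) u eq′
... | inj₁ (refl , refl) = last
  where
  last : IrreducibleAfter (k ∷ X ++ k ∷ X) (suc k)
  last a a<1+k with m≤n⇒m<n∨m≡n (≤-pred a<1+k)
  ... | inj₁ a<k  = IrreducibleAfter-++ˡ [ k ] (irr (X ++ k ∷ X) k [] refl (s≤s z≤n)) a a<k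
  ... | inj₂ refl = [] , a , X , overlapWord-∷ʳ a X
... | inj₂ (q , Y≡) = IrreducibleAfter-++ˡ [ k ]
  (irr u b (q ∷ʳ k) (trans (cong (_∷ʳ k) Y≡) (++-assoc u (b ∷ q) [ k ])) (s≤s z≤n))

chain-++ : ∀ n xs ys → chain n (xs ++ ys) ≡ chain n xs ++ chain n ys
chain-++ zero    xs ys = refl
chain-++ (suc n) xs ys =
  trans (cong (applyTab (phiTab n)) (chain-++ n xs ys))
        (concatMap-++ (lookupD (phiTab n)) (chain n xs) (chain n ys))

length-phiTab : ∀ n → length (phiTab n) ≡ suc n
length-phiTab zero    = refl
length-phiTab (suc n) =
  trans (length-++ (phiTab n)) (trans (cong (_+ 1) (length-phiTab n)) (+-comm (suc n) 1))

lookupD-++ˡ : ∀ (xs ys : List Word) {n} → n < length xs → lookupD (xs ++ ys) n ≡ lookupD xs n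
lookupD-++ˡ (x ∷ xs) ys {zero}  _         = refl
lookupD-++ˡ (x ∷ xs) ys {suc n} (s≤s n<) = lookupD-++ˡ xs ys n<

lookupD-∷ʳ : ∀ (xs : List Word) e → lookupD (xs ∷ʳ e) (length xs) ≡ e
lookupD-∷ʳ []       e = refl
lookupD-∷ʳ (x ∷ xs) e = lookupD-∷ʳ xs e

lookupD-phiTab : ∀ n {c} → c ≤ n → lookupD (phiTab n) c ≡ phiLetter c
lookupD-phiTab zero    z≤n = refl
lookupD-phiTab (suc n) c≤ with m≤n⇒m<n∨m≡n c≤
... | inj₂ refl = refl
... | inj₁ c<   =
  trans (lookupD-++ˡ (phiTab n) _ (subst (_ <_) (sym (length-phiTab n)) c<))
        (lookupD-phiTab n (≤-pred c<))

phiLetter-∷ʳ : ∀ n → phiLetter n ≡ Sinv (chain n (0 ∷ 0 ∷ [])) ∷ʳ suc n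
phiLetter-∷ʳ zero    = refl
phiLetter-∷ʳ (suc n) =
  subst (λ m → lookupD (phiTab (suc n)) m ≡ E) (length-phiTab n) (lookupD-∷ʳ (phiTab n) E)
  where E = Sinv (chain (suc n) (0 ∷ 0 ∷ [])) ∷ʳ suc (suc n)

Sinv-∷ʳ : ∀ ys c → Sinv (ys ∷ʳ c) ≡ c ∷ ys
Sinv-∷ʳ ys c with reverse (ys ∷ʳ c) | reverse-++ ys [ c ]
... | _ | refl = cong (c ∷_) (reverse-involutive ys)

chain-ends-with : ∀ n → ∃[ X ] chain n [ 0 ] ≡ X ∷ʳ n
chain-ends-with zero    = [] , refl
chain-ends-with (suc n) with X , eq ← chain-ends-with n =
  F X ++ Sinv (chain n (0 ∷ 0 ∷ [])) , (begin
  F (chain n [ 0 ])                                ≡⟨ cong F eq ⟩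
  F (X ∷ʳ n)                                       ≡⟨ concatMap-++ f X [ n ] ⟩
  F X ++ f n ++ []                                 ≡⟨ cong (F X ++_) (++-identityʳ (f n)) ⟩
  F X ++ f n                                       ≡⟨ cong (F X ++_) (lookupD-phiTab n ≤-refl) ⟩
  F X ++ phiLetter n                               ≡⟨ cong (F X ++_) (phiLetter-∷ʳ n) ⟩
  F X ++ Sinv (chain n (0 ∷ 0 ∷ [])) ∷ʳ suc n      ≡⟨ sym (++-assoc (F X) _ [ suc n ]) ⟩
  (F X ++ Sinv (chain n (0 ∷ 0 ∷ []))) ∷ʳ suc n    ∎)
  where
  open ≡-Reasoning
  f : ℕ → Word
  f = lookupD (phiTab n)
  F : Word → Word
  F = concatMap f

chain-00-shape : ∀ n → ∃[ X ] chain n (0 ∷ 0 ∷ []) ≡ (X ++ n ∷ X) ∷ʳ n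
  × phiLetter n ≡ n ∷ (X ++ n ∷ X) ∷ʳ suc n
chain-00-shape n with X , eq ← chain-ends-with n = X , chain≡ , (begin
  phiLetter n                                 ≡⟨ phiLetter-∷ʳ n ⟩
  Sinv (chain n (0 ∷ 0 ∷ [])) ∷ʳ suc n        ≡⟨ cong (λ w → Sinv w ∷ʳ suc n) chain≡ ⟩
  Sinv ((X ++ n ∷ X) ∷ʳ n) ∷ʳ suc n           ≡⟨ cong (_∷ʳ suc n) (Sinv-∷ʳ (X ++ n ∷ X) n) ⟩
  n ∷ (X ++ n ∷ X) ∷ʳ suc n                   ∎)
  where
  open ≡-Reasoning
  chain≡ : chain n (0 ∷ 0 ∷ []) ≡ (X ++ n ∷ X) ∷ʳ n
  chain≡ = begin
    chain n ([ 0 ] ++ [ 0 ])           ≡⟨ chain-++ n [ 0 ] [ 0 ] ⟩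
    chain n [ 0 ] ++ chain n [ 0 ]     ≡⟨ cong (λ w → w ++ w) eq ⟩
    X ∷ʳ n ++ X ∷ʳ n                   ≡⟨ ++-assoc X [ n ] (X ∷ʳ n) ⟩
    X ++ n ∷ X ∷ʳ n                    ≡⟨ sym (++-assoc X (n ∷ X) [ n ]) ⟩
    (X ++ n ∷ X) ∷ʳ n                  ∎

PowerInvariant : ℕ → Set
PowerInvariant n = IrreducibleFrom′ 1 (chain n (0 ∷ 0 ∷ [])) × All (_≤ n) (chain n (0 ∷ 0 ∷ []))

PowerInvariant⇒admissible : ∀ n → PowerInvariant n → Admissible n (phiLetter n)
PowerInvariant⇒admissible n (irr , _) with X , chain≡ , φn≡ ← chain-00-shape n = record
  { rest                  = (X ++ n ∷ X) ∷ʳ suc n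
  ; starts-with           = φn≡
  ; irreducibleAfterFirst =
      subst (IrreducibleFrom′ 2) (sym φn≡)
        (rotate-IrreducibleFrom′ n X (subst (IrreducibleFrom′ 1) chain≡ irr))
  }

PowerInvariant⇒phiLetter-bounded : ∀ n → PowerInvariant n → All (_≤ suc n) (phiLetter n)
PowerInvariant⇒phiLetter-bounded n (_ , bounded) with X , chain≡ , φn≡ ← chain-00-shape n =
  subst (All (_≤ suc n)) (sym φn≡)
    (n≤1+n n ∷ ++⁺ (All.map (λ c≤n → ≤-trans c≤n (n≤1+n n))
                      (++⁻ˡ (X ++ n ∷ X) (subst (All (_≤ n)) chain≡ bounded)))
                   (≤-refl ∷ []))

zeros-irreducible : IrreducibleFrom′ 1 (0 ∷ 0 ∷ [])
zeros-irreducible []              _ _ refl _ _ ()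
zeros-irreducible (_ ∷ [])        _ _ refl _ _ ()
zeros-irreducible (_ ∷ _ ∷ [])    _ _ ()
zeros-irreducible (_ ∷ _ ∷ _ ∷ _) _ _ ()

invariant : ∀ n → PowerInvariant n
invariant = <-rec PowerInvariant step
  where
  step : ∀ n → (∀ {c} → c < n → PowerInvariant c) → PowerInvariant n
  step zero    _     = zeros-irreducible , z≤n ∷ z≤n ∷ []
  step (suc n) invariant< =
      concatMap-IrreducibleFrom′ f w (s≤s z≤n) (All-AdmissibleUpTo admissible bounded) irr
    , concat⁺ (map⁺ (All.map image-bounded bounded))
    where
    f : ℕ → Word
    f = lookupD (phiTab n)
    w : Word
    w = chain n (0 ∷ 0 ∷ [])
    irr : IrreducibleFrom′ 1 w
    irr = proj₁ (invariant< ≤-refl)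
    bounded : All (_≤ n) w
    bounded = proj₂ (invariant< ≤-refl)
    admissible : ∀ {a} → a ≤ n → Admissible a (f a)
    admissible a≤n = subst (Admissible _) (sym (lookupD-phiTab n a≤n))
                       (PowerInvariant⇒admissible _ (invariant< (s≤s a≤n)))
    image-bounded : ∀ {b} → b ≤ n → All (_≤ suc n) (f b)
    image-bounded {b} b≤n = subst (All (_≤ suc n)) (sym (lookupD-phiTab n b≤n))
      (All.map (λ c≤ → ≤-trans c≤ (s≤s b≤n))
               (PowerInvariant⇒phiLetter-bounded b (invariant< (s≤s b≤n))))

phiLetter-admissible : ∀ a → Admissible a (phiLetter a)
phiLetter-admissible a = PowerInvariant⇒admissible a (invariant a)

theorem5 : ((h : ℕ) → IrreducibleMorphismH h × IrreducibleAfterFirstMorphismH h)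
           × IrreducibleMorphismPhi × IrreducibleAfterFirstMorphismPhi
theorem5 = (λ h → phiH-IrreducibleFrom h (s≤s z≤n) , phiH-IrreducibleFrom h ≤-refl)
         , phi-IrreducibleFrom (s≤s z≤n) , phi-IrreducibleFrom ≤-refl
  where
  phiH-IrreducibleFrom : ∀ h {k} → k ≤ 2 →
    ∀ w → All (_≤ h) w → IrreducibleFrom k w → IrreducibleFrom k (phiH h w)
  phiH-IrreducibleFrom h k≤2 w w≤h = concatMap-IrreducibleFrom _ w k≤2
    (All-AdmissibleUpTo (λ a≤h → subst (Admissible _) (sym (lookupD-phiTab h a≤h))
                                   (phiLetter-admissible _)) w≤h)
  phi-IrreducibleFrom : ∀ {k} → k ≤ 2 → ∀ w → IrreducibleFrom k w → IrreducibleFrom k (phi w)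
  phi-IrreducibleFrom k≤2 w = concatMap-IrreducibleFrom phiLetter w k≤2
    (All.universal (λ _ {a} _ → phiLetter-admissible a) w)
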